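{- Let $\mathbb{F}$ be a field of characteristic $0$, $n\in\mathbb{N}$, $\varkappa\in\mathbb{N}^n$ (all $\varkappa_j\ge1$), $N=|\varkappa|$, $m\in\mathbb{N}_0$ and $k\in\{1,\ldots,N\}$. Then the following identity holds in $\mathbb{F}(y_1,\ldots,y_n)$: \[ \bigl(\operatorname{adj}G_{(m),\varkappa}(y)\bigr)_{k,N}=\bigl(V_\varkappa(y)^{ -1}\bigr)_{k,N}\det V_\varkappa(y), \] where $\operatorname{adj}$ denotes the adjugate (transpose of the cofactor) matrix.
   Context: $\sigma(\varkappa)_q=\varkappa_1+\cdots+\varkappa_q$, $\sigma(\varkappa)_0=0$; every $k\in\{1,\ldots,N\}$ is written uniquely as $k=\sigma(\varkappa)_{q-1}+r$ with $q\in\{1,\ldots,n\}$, $r\in\{1,\ldots,\varkappa_q\}$. $G_{(m),\varkappa}(y)$ is the $N\times N$ matrix whose $(j,k)$ entry (with $k=\sigma(\varkappa)_{q-1}+r$) is: for $1\le j\le N-1$, $\binom{j-1}{r-1}y_q^{j-r}$ if $j\ge r$ and $0$ otherwise; for $j=N$, $\binom{N-1+m}{r-1}y_q^{m+N-r}$. The confluent Vandermonde matrix is $V_\varkappa(y)=G_{(0),\varkappa}(y)$. -}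

module Defs where

open import Level using (Level; _⊔_)
open import Algebra.Bundles using (CommutativeRing)
open import Data.Nat as ℕ using (ℕ; zero; suc; _<ᵇ_; _≤ᵇ_; _∸_)
open import Data.Nat.Combinatorics using (_C_)
open import Data.Bool using (Bool; true; false; if_then_else_)
open import Data.Fin as Fin using (Fin; zero; suc; toℕ; punchIn)
open import Data.Vec as Vec using (Vec; []; _∷_)
open import Data.Product using (Σ; _×_; _,_)
open import Relation.Nullary using (¬_)

record Field (c ℓ : Level) : Set (Level.suc (c ⊔ ℓ)) where
  field
    commutativeRing : CommutativeRing c ℓ
  open CommutativeRing commutativeRing public
  field
    1≉0     : ¬ (1# ≈ 0#)
    inverse : ∀ (x : Carrier) → ¬ (x ≈ 0#) → Σ Carrier (λ z → (x * z) ≈ 1#)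

module RingDefs {c ℓ : Level} (R : CommutativeRing c ℓ) where
  open CommutativeRing R hiding (zero)

  natC : ℕ → Carrier
  natC zero    = 0#
  natC (suc n) = 1# + natC n

  CharZero : Set ℓ
  CharZero = ∀ (n : ℕ) → ¬ (natC (suc n) ≈ 0#)

  pow : Carrier → ℕ → Carrier
  pow x zero    = 1#
  pow x (suc n) = x * pow x n

  sgn : ℕ → Carrier
  sgn zero    = 1#
  sgn (suc k) = - sgn k

  Mat : ℕ → Set c
  Mat n = Fin n → Fin n → Carrier

  sumF : ∀ n → (Fin n → Carrier) → Carrier
  sumF zero    f = 0#
  sumF (suc n) f = f zero + sumF n (λ i → f (suc i))

  minor : ∀ {n} → Fin (suc n) → Fin (suc n) → Mat (suc n) → Mat n
  minor i j A a b = A (punchIn i a) (punchIn j b)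

  det : ∀ n → Mat n → Carrier
  det zero    A = 1#
  det (suc n) A = sumF (suc n) (λ j → sgn (toℕ j) * (A zero j * det n (minor zero j A)))

  adj : ∀ n → Mat n → Mat n
  adj (suc n) A k j = sgn (toℕ k ℕ.+ toℕ j) * det n (minor j k A)

  matMul : ∀ n → Mat n → Mat n → Mat n
  matMul n A B i j = sumF n (λ l → A i l * B l j)

  idMat : ∀ n → Mat n
  idMat n i j with toℕ i ℕ.≟ toℕ j
  ... | Relation.Nullary.yes _ = 1#
  ... | Relation.Nullary.no  _ = 0#

  IsInverse : ∀ n → Mat n → Mat n → Set ℓ
  IsInverse n A W = (∀ i j → matMul n A W i j ≈ idMat n i j)
                  × (∀ i j → matMul n W A i j ≈ idMat n i j)

  -- For a 0-based column index c, returns (y_q , r) where c + 1 = σ(κ)_{q-1} + r,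
  -- 1 ≤ r ≤ κ_q.  (Out-of-range indices give a junk value; never used.)
  colInfo : ∀ {n} → Vec ℕ n → Vec Carrier n → ℕ → Carrier × ℕ
  colInfo []       []       c = 0# , 0
  colInfo (κ ∷ ks) (y ∷ ys) c = if c <ᵇ κ then (y , suc c) else colInfo ks ys (c ∸ κ)

  size : ∀ {n} → Vec ℕ n → ℕ
  size = Vec.sum

  -- entry (j,k) of G_{(m),κ}(y), with 1-based row j and column data (y_q , r)
  gEntry : ℕ → ℕ → ℕ → Carrier × ℕ → Carrier
  gEntry m N j (yq , r) =
    if j <ᵇ N
    then (if r ≤ᵇ j then natC ((j ∸ 1) C (r ∸ 1)) * pow yq (j ∸ r) else 0#)
    else natC ((N ∸ 1 ℕ.+ m) C (r ∸ 1)) * pow yq (m ℕ.+ N ∸ r)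

  G : ∀ {n} (m : ℕ) (κ : Vec ℕ n) (y : Vec Carrier n) → Mat (size κ)
  G m κ y i k = gEntry m (size κ) (suc (toℕ i)) (colInfo κ y (toℕ k))

  V : ∀ {n} (κ : Vec ℕ n) (y : Vec Carrier n) → Mat (size κ)
  V κ y = G 0 κ y

-- the last index N (1-based) of Fin N, available once Fin N is inhabited
lastOf : ∀ {N} → Fin N → Fin N
lastOf {suc N} _ = Fin.fromℕ N

-- G_{(m),κ}(y) and V_κ(y) differ only in their last row, and the cofactors along the last row
-- do not see that row, so adj G and adj V agree in column N.  For any square matrix A over a
-- commutative ring, A · adj A = det A · I: the diagonal entries are Laplace expansions along an
-- arbitrary row, obtained from the first-row expansion by exchanging the order of a double
-- expansion, and the off-diagonal ones are expansions of a matrix with two equal rows.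
-- Multiplying on the left by the inverse W gives adj V = W · det V.  The argument works over any
-- commutative ring.
module Submission where

open import Defs
open import Level using (Level)
open import Algebra.Bundles using (CommutativeRing)
open import Data.Nat as ℕ using (ℕ; zero; suc; _≤_; z<s; s<s)
import Data.Nat.Properties as ℕ
open import Data.Fin as Fin using (Fin; zero; suc; toℕ; punchIn; punchOut; fromℕ)
open import Data.Fin.Properties using (toℕ-injective; punchInᵢ≢i; punchIn-punchOut; punchOut-injective)
open import Data.Vec using (Vec)
open import Data.Vec.Relation.Unary.All using (All)
open import Data.Vec.Functional using (updateAt)
open import Data.Vec.Functional.Properties using (updateAt-updates; updateAt-minimal)
open import Data.Bool using (true)
open import Data.Empty using (⊥-elim)
open import Data.Product using (∃; _×_; _,_; proj₁; proj₂)
open import Data.Sum as Sum using (_⊎_; inj₁; inj₂)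
open import Function using (_∘_)
open import Relation.Nullary using (yes; no)
open import Relation.Binary.PropositionalEquality as ≡ using (_≡_; _≢_)

-- punchOut without the proof i ≢ j; the value at i ≡ j is junk.
punchOut′ : ∀ {n} → Fin (suc (suc n)) → Fin (suc (suc n)) → Fin (suc n)
punchOut′ zero    zero    = zero
punchOut′ zero    (suc j) = j
punchOut′ (suc i) zero    = zero
punchOut′ {zero}  (suc i) (suc j) = zero
punchOut′ {suc n} (suc i) (suc j) = suc (punchOut′ i j)

punchOut′-punchIn : ∀ {n} (i : Fin (suc (suc n))) (j : Fin (suc n)) → punchOut′ i (punchIn i j) ≡ j
punchOut′-punchIn zero    j       = ≡.refl
punchOut′-punchIn (suc i) zero    = ≡.refl
punchOut′-punchIn {suc n} (suc i) (suc j) = ≡.cong suc (punchOut′-punchIn i j)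

punchIn-punchOut′-comm : ∀ {n} {i j : Fin (suc (suc n))} → i ≢ j → (k : Fin n) →
  punchIn i (punchIn (punchOut′ i j) k) ≡ punchIn j (punchIn (punchOut′ j i) k)
punchIn-punchOut′-comm {_}     {zero}  {zero}  i≢j k = ⊥-elim (i≢j ≡.refl)
punchIn-punchOut′-comm {_}     {zero}  {suc j} _   k = ≡.refl
punchIn-punchOut′-comm {_}     {suc i} {zero}  _   k = ≡.refl
punchIn-punchOut′-comm {suc n} {suc i} {suc j} _   zero    = ≡.refl
punchIn-punchOut′-comm {suc n} {suc i} {suc j} i≢j (suc k) =
  ≡.cong suc (punchIn-punchOut′-comm (i≢j ∘ ≡.cong suc) k)

punchOut′-parity : ∀ {n} {i j : Fin (suc (suc n))} → i ≢ j →
  suc (toℕ i ℕ.+ toℕ (punchOut′ i j)) ≡ toℕ j ℕ.+ toℕ (punchOut′ j i)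
  ⊎ toℕ i ℕ.+ toℕ (punchOut′ i j) ≡ suc (toℕ j ℕ.+ toℕ (punchOut′ j i))
punchOut′-parity {_}     {zero}  {zero}  i≢j = ⊥-elim (i≢j ≡.refl)
punchOut′-parity {_}     {zero}  {suc j} _   = inj₁ (≡.cong suc (≡.sym (ℕ.+-identityʳ (toℕ j))))
punchOut′-parity {_}     {suc i} {zero}  _   = inj₂ (≡.cong suc (ℕ.+-identityʳ (toℕ i)))
punchOut′-parity {zero}  {suc zero} {suc zero} i≢j = ⊥-elim (i≢j ≡.refl)
punchOut′-parity {suc n} {suc i} {suc j} i≢j
  rewrite ℕ.+-suc (toℕ i) (toℕ (punchOut′ i j)) | ℕ.+-suc (toℕ j) (toℕ (punchOut′ j i)) =
  Sum.map (≡.cong (ℕ.suc ∘ ℕ.suc)) (≡.cong (ℕ.suc ∘ ℕ.suc)) (punchOut′-parity (i≢j ∘ ≡.cong suc))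

toℕ-punchIn-fromℕ< : ∀ {n} (i : Fin n) → toℕ (punchIn (fromℕ n) i) ℕ.< n
toℕ-punchIn-fromℕ< zero    = z<s
toℕ-punchIn-fromℕ< (suc i) = s<s (toℕ-punchIn-fromℕ< i)

third-index : ∀ {n} (p q : Fin (suc (suc (suc n)))) → ∃ λ r → r ≢ p × r ≢ q
third-index zero          zero          = suc zero , (λ ()) , (λ ())
third-index zero          (suc zero)    = suc (suc zero) , (λ ()) , (λ ())
third-index zero          (suc (suc q)) = suc zero , (λ ()) , (λ ())
third-index (suc zero)    zero          = suc (suc zero) , (λ ()) , (λ ())
third-index (suc zero)    (suc q)       = zero , (λ ()) , (λ ())
third-index (suc (suc p)) zero          = suc zero , (λ ()) , (λ ())
third-index (suc (suc p)) (suc q)       = zero , (λ ()) , (λ ())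

module Matrices {c ℓ : Level} (R : CommutativeRing c ℓ) where
  open CommutativeRing R hiding (zero)
  open RingDefs R
  open import Algebra.Properties.Ring ring using (-‿distribˡ-*; -‿involutive; +-cancelˡ)
  open import Algebra.Properties.Semiring.Sum semiring
  open import Algebra.Solver.CommutativeMonoid *-commutativeMonoid using (solve; _⊜_; _⊕_)
  open import Relation.Binary.Reasoning.Setoid setoid

  sumF≡sum : ∀ n (f : Fin n → Carrier) → sumF n f ≡ sum f
  sumF≡sum zero    f = ≡.refl
  sumF≡sum (suc n) f = ≡.cong (f zero +_) (sumF≡sum n (f ∘ suc))

  sum-zero : ∀ {n} {f : Fin n → Carrier} → (∀ i → f i ≈ 0#) → sum f ≈ 0#
  sum-zero {n} f≈0 = trans (sum-cong-≋ f≈0) (sum-replicate-zero n)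

  *-distribˡ-sum₂ : ∀ {n} x y (f : Fin n → Carrier) → x * (y * sum f) ≈ sum (λ i → x * (y * f i))
  *-distribˡ-sum₂ x y f = trans (*-congˡ (*-distribˡ-sum y f)) (*-distribˡ-sum x (λ i → y * f i))

  -- Adding the diagonal to either side gives the full double sum, in one order or the other.
  ∑-offDiagonal : ∀ {n} (g : Fin (suc n) → Fin (suc n) → Carrier) →
    ∑[ j < suc n ] ∑[ b < n ] g j (punchIn j b) ≈ ∑[ k < suc n ] ∑[ c < n ] g (punchIn k c) k
  ∑-offDiagonal {n} g = +-cancelˡ diagonal _ _ (begin
    diagonal + ∑[ j < suc n ] ∑[ b < n ] g j (punchIn j b)
      ≈⟨ sym (∑-distrib-+ (λ j → g j j) (λ j → ∑[ b < n ] g j (punchIn j b))) ⟩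
    ∑[ j < suc n ] (g j j + ∑[ b < n ] g j (punchIn j b))
      ≈⟨ sum-cong-≋ (λ j → sym (sum-remove {i = j} (g j))) ⟩
    ∑[ j < suc n ] ∑[ k < suc n ] g j k
      ≈⟨ ∑-comm g ⟩
    ∑[ k < suc n ] ∑[ j < suc n ] g j k
      ≈⟨ sum-cong-≋ (λ k → sum-remove {i = k} (λ j → g j k)) ⟩
    ∑[ k < suc n ] (g k k + ∑[ c < n ] g (punchIn k c) k)
      ≈⟨ ∑-distrib-+ (λ k → g k k) (λ k → ∑[ c < n ] g (punchIn k c) k) ⟩
    diagonal + ∑[ k < suc n ] ∑[ c < n ] g (punchIn k c) k ∎)
    where
      diagonal = ∑[ j < suc n ] g j j

  idMat-diagonal : ∀ n (i : Fin n) → idMat n i i ≈ 1#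
  idMat-diagonal n i with toℕ i ℕ.≟ toℕ i
  ... | yes _   = refl
  ... | no  i≢i = ⊥-elim (i≢i ≡.refl)

  idMat-offDiagonal : ∀ n {i j : Fin n} → i ≢ j → idMat n i j ≈ 0#
  idMat-offDiagonal n {i} {j} i≢j with toℕ i ℕ.≟ toℕ j
  ... | yes i≡j = ⊥-elim (i≢j (toℕ-injective i≡j))
  ... | no  _   = refl

  sum-idMatˡ : ∀ n (f : Fin n → Carrier) (j : Fin n) → ∑[ l < n ] (idMat n j l * f l) ≈ f j
  sum-idMatˡ (suc n) f j = begin
    ∑[ l < suc n ] (idMat (suc n) j l * f l)
      ≈⟨ sum-remove {i = j} (λ l → idMat (suc n) j l * f l) ⟩
    idMat (suc n) j j * f j + ∑[ b < n ] (idMat (suc n) j (punchIn j b) * f (punchIn j b))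
      ≈⟨ +-cong (trans (*-congʳ (idMat-diagonal _ j)) (*-identityˡ _))
                (sum-zero (λ b → trans (*-congʳ (idMat-offDiagonal _ (punchInᵢ≢i j b ∘ ≡.sym))) (zeroˡ _))) ⟩
    f j + 0#
      ≈⟨ +-identityʳ _ ⟩
    f j ∎

  sum-idMatʳ : ∀ n (f : Fin n → Carrier) (j : Fin n) → ∑[ l < n ] (f l * idMat n l j) ≈ f j
  sum-idMatʳ (suc n) f j = begin
    ∑[ l < suc n ] (f l * idMat (suc n) l j)
      ≈⟨ sum-remove {i = j} (λ l → f l * idMat (suc n) l j) ⟩
    f j * idMat (suc n) j j + ∑[ b < n ] (f (punchIn j b) * idMat (suc n) (punchIn j b) j)
      ≈⟨ +-cong (trans (*-congˡ (idMat-diagonal _ j)) (*-identityʳ _))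
                (sum-zero (λ b → trans (*-congˡ (idMat-offDiagonal _ (punchInᵢ≢i j b))) (zeroʳ _))) ⟩
    f j + 0#
      ≈⟨ +-identityʳ _ ⟩
    f j ∎

  sgn-+ : ∀ a b → sgn (a ℕ.+ b) ≈ sgn a * sgn b
  sgn-+ zero    b = sym (*-identityˡ _)
  sgn-+ (suc a) b = trans (-‿cong (sgn-+ a b)) (-‿distribˡ-* _ _)

  sgn-punchOut′-swap : ∀ {n} {i j : Fin (suc (suc n))} → i ≢ j →
    sgn (toℕ i ℕ.+ toℕ (punchOut′ i j)) ≈ - sgn (toℕ j ℕ.+ toℕ (punchOut′ j i))
  sgn-punchOut′-swap i≢j with punchOut′-parity i≢j
  ... | inj₁ 1+a≡b = sym (trans (-‿cong (reflexive (≡.cong sgn (≡.sym 1+a≡b)))) (-‿involutive _))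
  ... | inj₂ a≡1+b = reflexive (≡.cong sgn a≡1+b)

  -- Signs of one term of the double expansion along rows 0 and i + 1, taken in the two orders.
  sgn-exchange : ∀ i j p k q → sgn (j ℕ.+ p) ≈ - sgn (k ℕ.+ q) →
    sgn j * sgn (p ℕ.+ i) ≈ sgn (k ℕ.+ suc i) * sgn q
  sgn-exchange i j p k q swap = begin
    sgn j * sgn (p ℕ.+ i)      ≈⟨ sym (sgn-+ j (p ℕ.+ i)) ⟩
    sgn (j ℕ.+ (p ℕ.+ i))      ≈⟨ reflexive (≡.cong sgn (≡.sym (ℕ.+-assoc j p i))) ⟩
    sgn (j ℕ.+ p ℕ.+ i)        ≈⟨ sgn-+ (j ℕ.+ p) i ⟩
    sgn (j ℕ.+ p) * sgn i      ≈⟨ *-congʳ swap ⟩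
    - sgn (k ℕ.+ q) * sgn i    ≈⟨ sym (-‿distribˡ-* _ _) ⟩
    - (sgn (k ℕ.+ q) * sgn i)  ≈⟨ -‿cong (sym (sgn-+ (k ℕ.+ q) i)) ⟩
    sgn (suc (k ℕ.+ q ℕ.+ i))  ≈⟨ reflexive (≡.cong sgn (shuffle k q i)) ⟩
    sgn (k ℕ.+ suc i ℕ.+ q)    ≈⟨ sgn-+ (k ℕ.+ suc i) q ⟩
    sgn (k ℕ.+ suc i) * sgn q  ∎
    where
      shuffle : ∀ k q i → suc (k ℕ.+ q ℕ.+ i) ≡ k ℕ.+ suc i ℕ.+ q
      shuffle k q i = ≡.trans (≡.cong suc (ℕ.+-assoc k q i))
        (≡.trans (≡.cong (λ x → suc (k ℕ.+ x)) (ℕ.+-comm q i))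
          (≡.trans (≡.sym (ℕ.+-suc k (i ℕ.+ q))) (≡.sym (ℕ.+-assoc k (suc i) q))))

  det-suc : ∀ n (A : Mat (suc n)) →
    det (suc n) A ≈ ∑[ j < suc n ] (sgn (toℕ j) * (A zero j * det n (minor zero j A)))
  det-suc n A = reflexive (sumF≡sum (suc n) (λ j → sgn (toℕ j) * (A zero j * det n (minor zero j A))))

  det-cong : ∀ n {A B : Mat n} → (∀ i j → A i j ≈ B i j) → det n A ≈ det n B
  det-cong zero    A≈B = refl
  det-cong (suc n) {A} {B} A≈B = begin
    det (suc n) A
      ≈⟨ det-suc n A ⟩
    ∑[ j < suc n ] (sgn (toℕ j) * (A zero j * det n (minor zero j A)))
      ≈⟨ sum-cong-≋ (λ j → *-congˡ {sgn (toℕ j)} (*-cong (A≈B zero j) (det-cong n (λ a b → A≈B (suc a) (punchIn j b))))) ⟩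
    ∑[ j < suc n ] (sgn (toℕ j) * (B zero j * det n (minor zero j B)))
      ≈⟨ sym (det-suc n B) ⟩
    det (suc n) B ∎

  det-expand : ∀ n (A : Mat (suc n)) (i : Fin (suc n)) →
    det (suc n) A ≈ ∑[ k < suc n ] (A i k * adj (suc n) A k i)
  det-expand n A zero = trans (det-suc n A) (sum-cong-≋ reorder)
    where
      reorder : ∀ k → sgn (toℕ k) * (A zero k * det n (minor zero k A))
                    ≈ A zero k * (sgn (toℕ k ℕ.+ 0) * det n (minor zero k A))
      reorder k = begin
        sgn (toℕ k) * (A zero k * det n (minor zero k A))
          ≈⟨ solve 3 (λ s a d → s ⊕ (a ⊕ d) ⊜ a ⊕ (s ⊕ d)) refl _ _ _ ⟩
        A zero k * (sgn (toℕ k) * det n (minor zero k A))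
          ≈⟨ *-congˡ (*-congʳ (reflexive (≡.cong sgn (≡.sym (ℕ.+-identityʳ (toℕ k)))))) ⟩
        A zero k * (sgn (toℕ k ℕ.+ 0) * det n (minor zero k A)) ∎
  det-expand (suc n) A (suc i) = begin
    det (suc (suc n)) A
      ≈⟨ det-suc (suc n) A ⟩
    ∑[ j < suc (suc n) ] (sgn (toℕ j) * (A zero j * det (suc n) (minor zero j A)))
      ≈⟨ sum-cong-≋ expand-minor-of-row₀ ⟩
    ∑[ j < suc (suc n) ] ∑[ b < suc n ] T j (punchIn j b)
      ≈⟨ ∑-offDiagonal T ⟩
    ∑[ k < suc (suc n) ] ∑[ c < suc n ] T (punchIn k c) k
      ≈⟨ sum-cong-≋ (λ k → sum-cong-≋ (λ c → T≈U (punchInᵢ≢i k c))) ⟩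
    ∑[ k < suc (suc n) ] ∑[ c < suc n ] U k (punchIn k c)
      ≈⟨ sum-cong-≋ (λ k → sym (expand-minor-of-rowᵢ₊₁ k)) ⟩
    ∑[ k < suc (suc n) ] (A (suc i) k * adj (suc (suc n)) A k (suc i)) ∎
    where
      -- T j k and U k j are the same term of the double expansion along rows 0 and i + 1,
      -- reached through the entries A 0 j and A (i + 1) k in the two possible orders.
      T : Fin (suc (suc n)) → Fin (suc (suc n)) → Carrier
      T j k = sgn (toℕ j) * (A zero j * (A (suc i) k *
                (sgn (toℕ (punchOut′ j k) ℕ.+ toℕ i) * det n (minor i (punchOut′ j k) (minor zero j A)))))
      U : Fin (suc (suc n)) → Fin (suc (suc n)) → Carrier
      U k j = A (suc i) k * (sgn (toℕ k ℕ.+ toℕ (suc i)) *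
                (sgn (toℕ (punchOut′ k j)) * (A zero j * det n (minor zero (punchOut′ k j) (minor (suc i) k A)))))

      expand-minor-of-row₀ : ∀ j → sgn (toℕ j) * (A zero j * det (suc n) (minor zero j A))
                                ≈ ∑[ b < suc n ] T j (punchIn j b)
      expand-minor-of-row₀ j = begin
        sgn (toℕ j) * (A zero j * det (suc n) (minor zero j A))
          ≈⟨ *-congˡ (*-congˡ (det-expand n (minor zero j A) i)) ⟩
        sgn (toℕ j) * (A zero j * ∑[ b < suc n ] (A (suc i) (punchIn j b) * adj (suc n) (minor zero j A) b i))
          ≈⟨ *-distribˡ-sum₂ (sgn (toℕ j)) (A zero j) (λ b → A (suc i) (punchIn j b) * adj (suc n) (minor zero j A) b i) ⟩
        ∑[ b < suc n ] (sgn (toℕ j) * (A zero j * (A (suc i) (punchIn j b) * adj (suc n) (minor zero j A) b i)))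
          ≈⟨ sum-cong-≋ (λ b → reflexive (≡.cong (λ b′ → sgn (toℕ j) * (A zero j * (A (suc i) (punchIn j b) *
               (sgn (toℕ b′ ℕ.+ toℕ i) * det n (minor i b′ (minor zero j A))))))
               (≡.sym (punchOut′-punchIn j b)))) ⟩
        ∑[ b < suc n ] T j (punchIn j b) ∎

      expand-minor-of-rowᵢ₊₁ : ∀ k → A (suc i) k * adj (suc (suc n)) A k (suc i)
                                   ≈ ∑[ c < suc n ] U k (punchIn k c)
      expand-minor-of-rowᵢ₊₁ k = begin
        A (suc i) k * (sgn (toℕ k ℕ.+ toℕ (suc i)) * det (suc n) (minor (suc i) k A))
          ≈⟨ *-congˡ (*-congˡ (det-suc n (minor (suc i) k A))) ⟩
        A (suc i) k * (sgn (toℕ k ℕ.+ toℕ (suc i)) * ∑[ c < suc n ] (sgn (toℕ c) *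
          (A zero (punchIn k c) * det n (minor zero c (minor (suc i) k A)))))
          ≈⟨ *-distribˡ-sum₂ (A (suc i) k) (sgn (toℕ k ℕ.+ toℕ (suc i))) (λ c →
               sgn (toℕ c) * (A zero (punchIn k c) * det n (minor zero c (minor (suc i) k A)))) ⟩
        ∑[ c < suc n ] (A (suc i) k * (sgn (toℕ k ℕ.+ toℕ (suc i)) * (sgn (toℕ c) *
          (A zero (punchIn k c) * det n (minor zero c (minor (suc i) k A))))))
          ≈⟨ sum-cong-≋ (λ c → reflexive (≡.cong (λ c′ → A (suc i) k * (sgn (toℕ k ℕ.+ toℕ (suc i)) *
               (sgn (toℕ c′) * (A zero (punchIn k c) * det n (minor zero c′ (minor (suc i) k A))))))
               (≡.sym (punchOut′-punchIn k c)))) ⟩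
        ∑[ c < suc n ] U k (punchIn k c) ∎

      T≈U : ∀ {j k} → j ≢ k → T j k ≈ U k j
      T≈U {j} {k} j≢k = begin
        T j k
          ≈⟨ solve 5 (λ s₁ a x s₂ d → s₁ ⊕ (a ⊕ (x ⊕ (s₂ ⊕ d))) ⊜ (s₁ ⊕ s₂) ⊕ (a ⊕ (x ⊕ d))) refl _ _ _ _ _ ⟩
        (sgn (toℕ j) * sgn (toℕ p ℕ.+ toℕ i)) * (A zero j * (A (suc i) k * D))
          ≈⟨ *-cong (sgn-exchange (toℕ i) (toℕ j) (toℕ p) (toℕ k) (toℕ q) (sgn-punchOut′-swap j≢k))
                    (*-congˡ (*-congˡ D≈D′)) ⟩
        (sgn (toℕ k ℕ.+ toℕ (suc i)) * sgn (toℕ q)) * (A zero j * (A (suc i) k * D′))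
          ≈⟨ solve 5 (λ s₃ s₄ a x d → (s₃ ⊕ s₄) ⊕ (a ⊕ (x ⊕ d)) ⊜ x ⊕ (s₃ ⊕ (s₄ ⊕ (a ⊕ d)))) refl _ _ _ _ _ ⟩
        U k j ∎
        where
          p = punchOut′ j k
          q = punchOut′ k j
          D = det n (minor i p (minor zero j A))
          D′ = det n (minor zero q (minor (suc i) k A))
          D≈D′ : D ≈ D′
          D≈D′ = det-cong n (λ a b → reflexive (≡.cong (A (suc (punchIn i a))) (punchIn-punchOut′-comm j≢k b)))

  det₂ : ∀ (A : Mat 2) → det 2 A ≈ A zero zero * A (suc zero) (suc zero) - A zero (suc zero) * A (suc zero) zero
  det₂ A = +-cong (trans (*-identityˡ _) (*-congˡ (det₁ (minor zero zero A))))
                  (trans (+-identityʳ _) (trans (sym (-‿distribˡ-* _ _))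
                    (-‿cong (trans (*-identityˡ _) (*-congˡ (det₁ (minor zero (suc zero) A)))))))
    where
      det₁ : ∀ (M : Mat 1) → det 1 M ≈ M zero zero
      det₁ M = trans (+-identityʳ _) (trans (*-identityˡ _) (*-identityʳ _))

  -- For three or more rows, expand along a third row: every minor keeps the two equal rows.
  det-equalRows : ∀ n (A : Mat n) {p q : Fin n} → p ≢ q → (∀ z → A p z ≈ A q z) → det n A ≈ 0#
  det-equalRows 1 A {zero} {zero} p≢q _ = ⊥-elim (p≢q ≡.refl)
  det-equalRows 2 A {zero} {zero} p≢q _ = ⊥-elim (p≢q ≡.refl)
  det-equalRows 2 A {suc zero} {suc zero} p≢q _ = ⊥-elim (p≢q ≡.refl)
  det-equalRows 2 A {zero} {suc zero} _ A₀≈A₁ = begin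
    det 2 A                                                                 ≈⟨ det₂ A ⟩
    A zero zero * A (suc zero) (suc zero) - A zero (suc zero) * A (suc zero) zero
      ≈⟨ +-cong (*-congʳ (A₀≈A₁ zero)) (-‿cong (*-comm _ _)) ⟩
    A (suc zero) zero * A (suc zero) (suc zero) - A (suc zero) zero * A zero (suc zero)
      ≈⟨ +-congˡ (-‿cong (*-congˡ (A₀≈A₁ (suc zero)))) ⟩
    A (suc zero) zero * A (suc zero) (suc zero) - A (suc zero) zero * A (suc zero) (suc zero)
      ≈⟨ -‿inverseʳ _ ⟩
    0# ∎
  det-equalRows 2 A {suc zero} {zero} p≢q A₁≈A₀ =
    det-equalRows 2 A {zero} {suc zero} (p≢q ∘ ≡.sym) (sym ∘ A₁≈A₀)
  det-equalRows (suc (suc (suc n))) A {p} {q} p≢q Ap≈Aq = begin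
    det (suc (suc (suc n))) A
      ≈⟨ det-expand (suc (suc n)) A r ⟩
    ∑[ k < suc (suc (suc n)) ] (A r k * (sgn (toℕ k ℕ.+ toℕ r) * det (suc (suc n)) (minor r k A)))
      ≈⟨ sum-zero (λ k → trans (*-congˡ {A r k} (*-congˡ {sgn (toℕ k ℕ.+ toℕ r)}
                   (det-equalRows (suc (suc n)) (minor r k A) (p≢q ∘ punchOut-injective r≢p r≢q) (minor-rows k))))
                 (trans (*-congˡ (zeroʳ _)) (zeroʳ _))) ⟩
    0# ∎
    where
      r = proj₁ (third-index p q)
      r≢p = proj₁ (proj₂ (third-index p q))
      r≢q = proj₂ (proj₂ (third-index p q))
      rowOf : ∀ {s} (r≢s : r ≢ s) k z → minor r k A (punchOut r≢s) z ≡ A s (punchIn k z)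
      rowOf r≢s k z = ≡.cong (λ t → A t (punchIn k z)) (punchIn-punchOut r≢s)
      minor-rows : ∀ k z → minor r k A (punchOut r≢p) z ≈ minor r k A (punchOut r≢q) z
      minor-rows k z = trans (reflexive (rowOf r≢p k z)) (trans (Ap≈Aq (punchIn k z)) (reflexive (≡.sym (rowOf r≢q k z))))

  matMul≈∑ : ∀ n (A B : Mat n) i j → matMul n A B i j ≈ ∑[ l < n ] (A i l * B l j)
  matMul≈∑ n A B i j = reflexive (sumF≡sum n (λ l → A i l * B l j))

  matMul-cong : ∀ n {A A′ B B′ : Mat n} → (∀ i j → A i j ≈ A′ i j) → (∀ i j → B i j ≈ B′ i j) →
    ∀ i j → matMul n A B i j ≈ matMul n A′ B′ i j
  matMul-cong n {A} {A′} {B} {B′} A≈A′ B≈B′ i j = begin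
    matMul n A B i j               ≈⟨ matMul≈∑ n A B i j ⟩
    ∑[ l < n ] (A i l * B l j)     ≈⟨ sum-cong-≋ (λ l → *-cong (A≈A′ i l) (B≈B′ l j)) ⟩
    ∑[ l < n ] (A′ i l * B′ l j)   ≈⟨ sym (matMul≈∑ n A′ B′ i j) ⟩
    matMul n A′ B′ i j             ∎

  matMul-identityˡ : ∀ n (A : Mat n) i j → matMul n (idMat n) A i j ≈ A i j
  matMul-identityˡ n A i j = trans (matMul≈∑ n (idMat n) A i j) (sum-idMatˡ n (λ l → A l j) i)

  matMul-assoc : ∀ n (A B C : Mat n) i j →
    matMul n (matMul n A B) C i j ≈ matMul n A (matMul n B C) i j
  matMul-assoc n A B C i j = begin
    matMul n (matMul n A B) C i j
      ≈⟨ matMul≈∑ n (matMul n A B) C i j ⟩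
    ∑[ l < n ] (matMul n A B i l * C l j)
      ≈⟨ sum-cong-≋ (λ l → trans (*-congʳ (matMul≈∑ n A B i l)) (*-distribʳ-sum (C l j) (λ m → A i m * B m l))) ⟩
    ∑[ l < n ] ∑[ m < n ] (A i m * B m l * C l j)
      ≈⟨ ∑-comm (λ l m → A i m * B m l * C l j) ⟩
    ∑[ m < n ] ∑[ l < n ] (A i m * B m l * C l j)
      ≈⟨ sum-cong-≋ (λ m → trans (sum-cong-≋ (λ l → *-assoc (A i m) (B m l) (C l j)))
                                 (sym (*-distribˡ-sum (A i m) (λ l → B m l * C l j)))) ⟩
    ∑[ m < n ] (A i m * ∑[ l < n ] (B m l * C l j))
      ≈⟨ sum-cong-≋ (λ m → *-congˡ (sym (matMul≈∑ n B C m j))) ⟩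
    ∑[ m < n ] (A i m * matMul n B C m j)
      ≈⟨ sym (matMul≈∑ n A (matMul n B C) i j) ⟩
    matMul n A (matMul n B C) i j ∎

  adj-cong-offRow : ∀ n {A B : Mat (suc n)} (k L : Fin (suc n)) →
    (∀ a z → A (punchIn L a) z ≈ B (punchIn L a) z) → adj (suc n) A k L ≈ adj (suc n) B k L
  adj-cong-offRow n k L A≈B = *-congˡ (det-cong n (λ a b → A≈B a (punchIn k b)))

  -- Off the diagonal, row l paired with the cofactors of row L is the Laplace expansion of A
  -- with row L overwritten by row l.
  matMul-adj : ∀ n (A : Mat (suc n)) l L →
    matMul (suc n) A (adj (suc n) A) l L ≈ idMat (suc n) l L * det (suc n) A
  matMul-adj n A l L with l Fin.≟ L
  ... | yes ≡.refl = begin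
    matMul (suc n) A (adj (suc n) A) L L             ≈⟨ matMul≈∑ (suc n) A (adj (suc n) A) L L ⟩
    ∑[ i < suc n ] (A L i * adj (suc n) A i L)       ≈⟨ sym (det-expand n A L) ⟩
    det (suc n) A                                    ≈⟨ sym (*-identityˡ _) ⟩
    1# * det (suc n) A                               ≈⟨ *-congʳ (sym (idMat-diagonal (suc n) L)) ⟩
    idMat (suc n) L L * det (suc n) A                ∎
  ... | no l≢L = begin
    matMul (suc n) A (adj (suc n) A) l L             ≈⟨ matMul≈∑ (suc n) A (adj (suc n) A) l L ⟩
    ∑[ i < suc n ] (A l i * adj (suc n) A i L)
      ≈⟨ sum-cong-≋ (λ i → *-cong (reflexive (≡.sym (≡.cong-app (updateAt-updates L {λ _ → A l} A) i)))
                                  (adj-cong-offRow n {A} {A′} i L (λ a z → reflexive (≡.sym (≡.cong-app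
                                    (updateAt-minimal (punchIn L a) L {λ _ → A l} A (punchInᵢ≢i L a)) z))))) ⟩
    ∑[ i < suc n ] (A′ L i * adj (suc n) A′ i L)     ≈⟨ sym (det-expand n A′ L) ⟩
    det (suc n) A′
      ≈⟨ det-equalRows (suc n) A′ l≢L (λ z → reflexive (≡.cong-app
           (≡.trans (updateAt-minimal l L {λ _ → A l} A l≢L) (≡.sym (updateAt-updates L {λ _ → A l} A))) z)) ⟩
    0#                                               ≈⟨ sym (zeroˡ _) ⟩
    0# * det (suc n) A                               ≈⟨ *-congʳ (sym (idMat-offDiagonal (suc n) l≢L)) ⟩
    idMat (suc n) l L * det (suc n) A                ∎
    where
      A′ : Mat (suc n)
      A′ = updateAt A L (λ _ → A l)

  adj≈inverse*det : ∀ n {A W : Mat (suc n)} → (∀ i j → matMul (suc n) W A i j ≈ idMat (suc n) i j) →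
    ∀ k L → adj (suc n) A k L ≈ W k L * det (suc n) A
  adj≈inverse*det n {A} {W} W*A≈I k L = begin
    adj N A k L                                      ≈⟨ sym (matMul-identityˡ N (adj N A) k L) ⟩
    matMul N (idMat N) (adj N A) k L                 ≈⟨ sym (matMul-cong N {B = adj N A} W*A≈I (λ _ _ → refl) k L) ⟩
    matMul N (matMul N W A) (adj N A) k L            ≈⟨ matMul-assoc N W A (adj N A) k L ⟩
    matMul N W (matMul N A (adj N A)) k L            ≈⟨ matMul-cong N {A = W} (λ _ _ → refl) (matMul-adj n A) k L ⟩
    matMul N W (λ l L′ → idMat N l L′ * det N A) k L ≈⟨ matMul≈∑ N W (λ l L′ → idMat N l L′ * det N A) k L ⟩
    ∑[ l < N ] (W k l * (idMat N l L * det N A))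
      ≈⟨ sum-cong-≋ (λ l → solve 3 (λ w e d → w ⊕ (e ⊕ d) ⊜ (w ⊕ d) ⊕ e) refl (W k l) (idMat N l L) (det N A)) ⟩
    ∑[ l < N ] (W k l * det N A * idMat N l L)       ≈⟨ sum-idMatʳ N (λ l → W k l * det N A) L ⟩
    W k L * det N A                                  ∎
    where
      N = suc n

  adj-lastColumn≈inverse*det : ∀ N (A B W : Mat N) (k : Fin N) →
    (∀ i → suc (toℕ i) ℕ.< N → ∀ z → B i z ≈ A i z) →
    (∀ i j → matMul N W A i j ≈ idMat N i j) →
    adj N B k (lastOf k) ≈ W k (lastOf k) * det N A
  adj-lastColumn≈inverse*det (suc n) A B W k B≈A W*A≈I =
    trans (adj-cong-offRow n {B} {A} k (fromℕ n) (λ a → B≈A (punchIn (fromℕ n) a) (s<s (toℕ-punchIn-fromℕ< a))))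
          (adj≈inverse*det n {A} {W} W*A≈I k (fromℕ n))

gEntry-upperRow : ∀ {c ℓ} (R : CommutativeRing c ℓ) m m′ N j p → j ℕ.< N →
  RingDefs.gEntry R m N j p ≡ RingDefs.gEntry R m′ N j p
gEntry-upperRow R m m′ N j (yq , r) j<N with j ℕ.<ᵇ N | ℕ.<⇒<ᵇ j<N
... | true | _ = ≡.refl

proposition9p2 : ∀ {c ℓ : Level} (F : Field c ℓ)
    → let open Field F in let open RingDefs commutativeRing in
      CharZero
    → ∀ (n : ℕ) (κ : Vec ℕ n) → All (1 ≤_) κ
    → ∀ (m : ℕ) (k : Fin (size κ))
    → ∀ (y : Vec Carrier n) (W : Mat (size κ)) → IsInverse (size κ) (V κ y) W
    → adj (size κ) (G m κ y) k (lastOf k) ≈ W k (lastOf k) * det (size κ) (V κ y)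
proposition9p2 F _ n κ _ m k y W (_ , W*V≈I) =
  adj-lastColumn≈inverse*det (size κ) (V κ y) (G m κ y) W k
    (λ i i<N z → reflexive (gEntry-upperRow commutativeRing m 0 (size κ) (suc (toℕ i)) (colInfo κ y (toℕ z)) i<N))
    W*V≈I
  where
    open Field F
    open RingDefs commutativeRing
    open Matrices commutativeRing
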